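{- Let $G$ be a finite connected graph of order $n$, minimum degree $\delta$, maximum degree $\Delta$ and domination number $\gamma(G)$. Then $$\gamma_{s}(G)\geq -n+2\max\left\{\left\lceil\frac{\Delta+2}{2}\right\rceil,\ \left\lceil\frac{\delta+2\gamma(G)}{2}\right\rceil\right\}.$$ Moreover, the bound is sharp: equality holds for every complete graph $K_n$.
   Context: A signed dominating function (SDF) of $G$ is a function $f:V(G)\to\{ -1,1\}$ with $f(N[v])=\sum_{u\in N[v]}f(u)\geq 1$ for every vertex $v$, where $N[v]$ is the closed neighborhood; $\gamma_s(G)$ is the minimum of $\sum_{v} f(v)$ over all SDFs. $\gamma(G)$ is the minimum cardinality of a dominating set (a set $D$ such that every vertex outside $D$ has a neighbor in $D$). -}

module Defs where

open import Data.Nat as ℕ using (ℕ; zero; suc; _⊔_; _⊓_; ⌈_/2⌉)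
open import Data.Integer as ℤ using (ℤ; +_; -[1+_])
open import Data.Bool using (Bool; true; false; if_then_else_; _∨_)
open import Data.Fin using (Fin; zero; suc; _≟_)
open import Data.Fin.Subset using (Subset; _∈_; ∣_∣)
open import Data.List using (List; foldr; allFin; filter; length)
open import Data.Product using (Σ; _×_; _,_)
open import Data.Sum using (_⊎_)
open import Relation.Nullary using (¬_)
open import Relation.Nullary.Decidable using (⌊_⌋)
open import Relation.Binary.PropositionalEquality using (_≡_)

record Graph (n : ℕ) : Set where
  field
    adj       : Fin n → Fin n → Bool
    adj-sym   : ∀ u v → adj u v ≡ adj v u
    adj-irrefl : ∀ v → adj v v ≡ false
open Graph public

Adj : ∀ {n} → Graph n → Fin n → Fin n → Set
Adj G u v = adj G u v ≡ true

data Reach {n} (G : Graph n) : Fin n → Fin n → Set where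
  here : ∀ {v} → Reach G v v
  step : ∀ {u v w} → Adj G u v → Reach G v w → Reach G u w

Connected : ∀ {n} → Graph n → Set
Connected {n} G = ∀ (u v : Fin n) → Reach G u v

deg : ∀ {n} → Graph n → Fin n → ℕ
deg {n} G v = length (filter (λ u → adj G v u ≡? true) (allFin n))
  where
  open import Data.Bool.Properties using () renaming (_≟_ to _≡?_)

maxDeg : ∀ {m} → Graph (suc m) → ℕ
maxDeg {m} G = foldr (λ v acc → deg G v ⊔ acc) 0 (allFin (suc m))

minDeg : ∀ {m} → Graph (suc m) → ℕ
minDeg {m} G = foldr (λ v acc → deg G v ⊓ acc) (deg G zero) (allFin (suc m))

IsDominating : ∀ {n} → Graph n → Subset n → Set
IsDominating {n} G D = ∀ (v : Fin n) → ¬ (v ∈ D) → Σ (Fin n) (λ u → u ∈ D × Adj G v u)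

IsDominationNumber : ∀ {n} → Graph n → ℕ → Set
IsDominationNumber {n} G k =
  Σ (Subset n) (λ D → IsDominating G D × ∣ D ∣ ≡ k)
  × (∀ (D : Subset n) → IsDominating G D → k ℕ.≤ ∣ D ∣)

sumℤ : ∀ {n} → (Fin n → ℤ) → ℤ
sumℤ {n} f = foldr (λ v acc → f v ℤ.+ acc) (+ 0) (allFin n)

closedNbhdSum : ∀ {n} → Graph n → (Fin n → ℤ) → Fin n → ℤ
closedNbhdSum G f v =
  sumℤ (λ u → if (⌊ u ≟ v ⌋ ∨ adj G v u) then f u else + 0)

IsSDF : ∀ {n} → Graph n → (Fin n → ℤ) → Set
IsSDF {n} G f =
  (∀ (v : Fin n) → f v ≡ + 1 ⊎ f v ≡ -[1+ 0 ])
  × (∀ (v : Fin n) → + 1 ℤ.≤ closedNbhdSum G f v)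

IsSignedDominationNumber : ∀ {n} → Graph n → ℤ → Set
IsSignedDominationNumber {n} G s =
  Σ (Fin n → ℤ) (λ f → IsSDF G f × sumℤ f ≡ s)
  × (∀ (f : Fin n → ℤ) → IsSDF G f → s ℤ.≤ sumℤ f)

complete : ∀ n → Graph n
complete n = record
  { adj = λ u v → if ⌊ u ≟ v ⌋ then false else true
  ; adj-sym = sym'
  ; adj-irrefl = irr }
  where
  open import Relation.Binary.PropositionalEquality using (refl; sym)
  open import Relation.Nullary using (yes; no)
  sym' : ∀ u v → (if ⌊ u ≟ v ⌋ then false else true) ≡ (if ⌊ v ≟ u ⌋ then false else true)
  sym' u v with u ≟ v | v ≟ u
  ... | yes _ | yes _ = refl
  ... | no _ | no _ = refl
  ... | yes p | no q = Data.Empty.⊥-elim (q (sym p)) where import Data.Empty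
  ... | no p | yes q = Data.Empty.⊥-elim (p (sym q)) where import Data.Empty
  irr : ∀ v → (if ⌊ v ≟ v ⌋ then false else true) ≡ false
  irr v with v ≟ v
  ... | yes _ = refl
  ... | no p = Data.Empty.⊥-elim (p refl) where import Data.Empty

bound : (n Δ δ γ : ℕ) → ℤ
bound n Δ δ γ = ℤ.- (+ n) ℤ.+ + (2 ℕ.* (⌈ Δ ℕ.+ 2 /2⌉ ⊔ ⌈ δ ℕ.+ 2 ℕ.* γ /2⌉))

-- Let P be the set of positive vertices of an SDF f and p = |P|, so w(f) = 2p - n.
-- The condition f(N[v]) ≥ 1 says that N[v] has a strict majority of positive
-- vertices, so deg v + 2 ≤ 2 |N[v] ∩ P| ≤ 2p, which is the Δ-bound.  With δ ≤ deg v
-- it gives |N[v] ∩ P| > ⌈δ/2⌉ for every v; so after deleting any ⌈δ/2⌉ vertices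
-- from P, the rest still meets every closed neighbourhood, i.e. it is a dominating
-- set, and γ ≤ p - ⌈δ/2⌉ is the γ-bound.  For K_n, giving +1 to exactly
-- ⌈(n+1)/2⌉ vertices is an SDF, and its weight is the bound.
module Submission where

open import Defs
open import Data.Nat using (ℕ; suc)
open import Data.Integer using (ℤ; _≤_)
open import Data.Product using (_×_)
open import Relation.Binary.PropositionalEquality using (_≡_)

open import Data.Nat as ℕ using (zero; _+_; _*_; _<_; _⊔_; _⊓_; ⌈_/2⌉; ⌊_/2⌋; s≤s)
import Data.Nat.Properties as ℕₚ
open import Data.Integer as ℤ using (+_; -[1+_])
import Data.Integer.Properties as ℤₚ
open import Data.Integer.Tactic.RingSolver using (solve-∀)
open import Data.Bool using (Bool; true; false; if_then_else_; _∨_; _∧_; not)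
open import Data.Bool.Properties using (∧-assoc; ∧-zeroʳ) renaming (_≟_ to _≟ᵇ_)
open import Data.Fin using (Fin; zero; suc; _≟_)
open import Data.Fin.Subset using (_∈_; ∣_∣; ⁅_⁆)
open import Data.Fin.Subset.Properties using (∣⁅x⁆∣≡1; x∈⁅x⁆)
open import Data.List using (List; []; _∷_; foldr; allFin; tabulate; filter; length; map)
open import Data.List.Properties using (foldr-map; map-tabulate)
open import Data.List.Membership.Propositional using () renaming (_∈_ to _∈ˡ_)
open import Data.List.Membership.Propositional.Properties using (∈-allFin)
open import Data.List.Relation.Unary.Any using (here; there)
import Data.Vec as Vec
import Data.Vec.Properties as Vecₚ
import Data.Vec.Functional as Vector
open import Data.Product using (∃-syntax; _,_; proj₁; proj₂)
open import Data.Sum using (_⊎_; inj₁; inj₂)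
open import Data.Empty using (⊥-elim)
open import Function using (_∘_; id)
open import Relation.Nullary using (¬_; yes; no)
open import Relation.Nullary.Decidable using (⌊_⌋)
open import Relation.Binary.PropositionalEquality
  using (refl; sym; trans; cong; cong₂; subst; subst₂; module ≡-Reasoning)

private
  variable
    m n : ℕ

_⊆ᵇ_ : (Fin n → Bool) → (Fin n → Bool) → Set
p ⊆ᵇ q = ∀ i → p i ≡ true → q i ≡ true

count : (Fin n → Bool) → ℕ
count {zero}  p = 0
count {suc n} p = (if p zero then 1 else 0) + count (p ∘ suc)

count-cong : {p q : Fin n → Bool} → (∀ i → p i ≡ q i) → count p ≡ count q
count-cong {zero}  p≡q = refl
count-cong {suc n} p≡q =
  cong₂ _+_ (cong (λ b → if b then 1 else 0) (p≡q zero)) (count-cong (p≡q ∘ suc))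

count-true : count {n} (λ _ → true) ≡ n
count-true {zero}  = refl
count-true {suc n} = cong suc count-true

count-false : count {n} (λ _ → false) ≡ 0
count-false {zero}  = refl
count-false {suc n} = count-false {n}

count-∧-split : (p t : Fin n → Bool) →
  count (λ i → p i ∧ t i) + count (λ i → p i ∧ not (t i)) ≡ count p
count-∧-split {zero}  p t = refl
count-∧-split {suc n} p t with p zero | t zero | count-∧-split (p ∘ suc) (t ∘ suc)
... | true  | true  | ih = cong suc ih
... | true  | false | ih = trans (ℕₚ.+-suc _ _) (cong suc ih)
... | false | _     | ih = ih

∧≡true : ∀ {a b} → a ∧ b ≡ true → a ≡ true × b ≡ true
∧≡true {true} {true} refl = refl , refl

∧-⊆ʳ : (p q : Fin n → Bool) → (λ i → p i ∧ q i) ⊆ᵇ q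
∧-⊆ʳ p q i = proj₂ ∘ ∧≡true

⊆ᵇ⇒∧≡ : {r s : Fin n → Bool} → r ⊆ᵇ s → ∀ i → s i ∧ r i ≡ r i
⊆ᵇ⇒∧≡ {r = r} {s} r⊆s i with r i in ri≡
... | true  = cong (_∧ true) (r⊆s i ri≡)
... | false = ∧-zeroʳ (s i)

count+count∖≡count : {r s : Fin n → Bool} → r ⊆ᵇ s → count r + count (λ i → s i ∧ not (r i)) ≡ count s
count+count∖≡count {r = r} {s} r⊆s =
  trans (cong (_+ count (λ i → s i ∧ not (r i))) (sym (count-cong (⊆ᵇ⇒∧≡ r⊆s)))) (count-∧-split s r)

count-mono : {p q : Fin n → Bool} → p ⊆ᵇ q → count p ℕ.≤ count q
count-mono {zero}          p⊆q = ℕ.z≤n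
count-mono {suc n} {p} {q} p⊆q = ℕₚ.+-mono-≤ (head (p zero) (q zero) (p⊆q zero)) (count-mono (p⊆q ∘ suc))
  where
  head : ∀ a b → (a ≡ true → b ≡ true) → (if a then 1 else 0) ℕ.≤ (if b then 1 else 0)
  head true  b a⇒b rewrite a⇒b refl = ℕₚ.≤-refl
  head false b _   = ℕ.z≤n

count>0⇒∃ : (p : Fin n → Bool) → 0 < count p → ∃[ i ] p i ≡ true
count>0⇒∃ {suc n} p 0<c with p zero in p0≡
... | true  = zero , p0≡
... | false with count>0⇒∃ (p ∘ suc) 0<c
...   | i , pi≡ = suc i , pi≡

⌊suc≟suc⌋ : (i j : Fin n) → ⌊ suc i ≟ suc j ⌋ ≡ ⌊ i ≟ j ⌋
⌊suc≟suc⌋ i j with i ≟ j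
... | yes _ = refl
... | no  _ = refl

count-insert : (q : Fin n → Bool) (v : Fin n) → q v ≡ false →
  count (λ u → ⌊ u ≟ v ⌋ ∨ q u) ≡ suc (count q)
count-insert {suc n} q zero    qv≡ rewrite qv≡ = refl
count-insert {suc n} q (suc v) qv≡ = trans
  (cong (λ c → (if q zero then 1 else 0) + c)
    (trans (count-cong (λ i → cong (_∨ q (suc i)) (⌊suc≟suc⌋ i v)))
           (count-insert (q ∘ suc) v qv≡)))
  (ℕₚ.+-suc _ _)

∃⊆-count≡ : (s : Fin n → Bool) {k : ℕ} → k ℕ.≤ count s → ∃[ r ] r ⊆ᵇ s × count r ≡ k
∃⊆-count≡ {zero}  s ℕ.z≤n = (λ ()) , (λ ()) , refl
∃⊆-count≡ {suc n} s {zero} _ = (λ _ → false) , (λ _ ()) , count-false {suc n}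
∃⊆-count≡ {suc n} s {suc k} k≤c with s zero in s0≡
... | true with ∃⊆-count≡ (s ∘ suc) (ℕₚ.≤-pred k≤c)
...   | r , r⊆s , cr≡ = (true Vector.∷ r) , (λ { zero _ → s0≡ ; (suc i) → r⊆s i }) , cong suc cr≡
∃⊆-count≡ {suc n} s {suc k} k≤c | false with ∃⊆-count≡ (s ∘ suc) k≤c
...   | r , r⊆s , cr≡ = (false Vector.∷ r) , (λ { zero () ; (suc i) → r⊆s i }) , cr≡

length-filter-tabulate : ∀ {k} (p : Fin n → Bool) (g : Fin k → Fin n) →
  length (filter (λ u → p u ≟ᵇ true) (tabulate g)) ≡ count (p ∘ g)
length-filter-tabulate {k = zero}  p g = refl
length-filter-tabulate {k = suc k} p g with p (g zero)
... | true  = cong suc (length-filter-tabulate p (g ∘ suc))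
... | false = length-filter-tabulate p (g ∘ suc)

deg≡count : (G : Graph n) (v : Fin n) → deg G v ≡ count (adj G v)
deg≡count G v = length-filter-tabulate (adj G v) id

sumℤ-suc : (f : Fin (suc n) → ℤ) → sumℤ f ≡ f zero ℤ.+ sumℤ (f ∘ suc)
sumℤ-suc {n} f = cong (ℤ._+_ (f zero)) (begin
  foldr add (+ 0) (tabulate suc)          ≡⟨ cong (foldr add (+ 0)) (sym (map-tabulate id suc)) ⟩
  foldr add (+ 0) (map suc (allFin n))    ≡⟨ foldr-map add suc (+ 0) (allFin n) ⟩
  sumℤ (f ∘ suc)                           ∎)
  where
  open ≡-Reasoning
  add : Fin (suc n) → ℤ → ℤ
  add v acc = f v ℤ.+ acc

sign : Bool → ℤ
sign true  = + 1
sign false = -[1+ 0 ]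

signed-cons : ∀ c s x {X A B} → x ≡ sign s → X ℤ.+ + B ≡ + A →
  ((if c then x else + 0) ℤ.+ X) ℤ.+ + ((if c ∧ not s then 1 else 0) + B)
    ≡ + ((if c ∧ s then 1 else 0) + A)
signed-cons true  true  _ {X} {A} {B} refl ih = trans (ℤₚ.+-assoc (+ 1) X (+ B)) (cong (ℤ._+_ (+ 1)) ih)
signed-cons true  false _ {X} {A} {B} refl ih = trans (cancel X (+ B)) ih
  where
  cancel : ∀ x y → (-[1+ 0 ] ℤ.+ x) ℤ.+ (+ 1 ℤ.+ y) ≡ x ℤ.+ y
  cancel = solve-∀
signed-cons false _     _ {X} {A} {B} _    ih = trans (cong (ℤ._+ + B) (ℤₚ.+-identityˡ X)) ih

-- Stated without subtraction: the left side adds back the negative vertices.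
sumℤ-signed : (c s : Fin n → Bool) (f : Fin n → ℤ) → (∀ u → f u ≡ sign (s u)) →
  sumℤ (λ u → if c u then f u else + 0) ℤ.+ + count (λ u → c u ∧ not (s u))
    ≡ + count (λ u → c u ∧ s u)
sumℤ-signed {zero}  c s f f≡ = refl
sumℤ-signed {suc n} c s f f≡ rewrite sumℤ-suc (λ u → if c u then f u else + 0) =
  signed-cons (c zero) (s zero) (f zero) (f≡ zero) (sumℤ-signed (c ∘ suc) (s ∘ suc) (f ∘ suc) (f≡ ∘ suc))

module _ {S : ℤ} {a b : ℕ} (S+b≡a : S ℤ.+ + b ≡ + a) where

  1≤S⇒b<a : + 1 ≤ S → b < a
  1≤S⇒b<a 1≤S = ℤₚ.drop‿+≤+ (subst (+ suc b ≤_) S+b≡a (ℤₚ.+-monoˡ-≤ (+ b) 1≤S))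

  b<a⇒1≤S : b < a → + 1 ≤ S
  b<a⇒1≤S b<a = subst₂ _≤_ (cancel (+ 1) (+ b))
    (trans (cong (ℤ._- + b) (sym S+b≡a)) (cancel S (+ b)))
    (ℤₚ.+-monoˡ-≤ (ℤ.- + b) (ℤ.+≤+ b<a))
    where
    cancel : ∀ x y → x ℤ.+ y ℤ.- y ≡ x
    cancel = solve-∀

  -[a+b]+2a≡S : ℤ.- + (a + b) ℤ.+ + (2 * a) ≡ S
  -[a+b]+2a≡S = trans (cong (λ x → ℤ.- (x ℤ.+ + b) ℤ.+ (x ℤ.+ (x ℤ.+ + 0))) (sym S+b≡a)) (simplify S (+ b))
    where
    simplify : ∀ s y → ℤ.- ((s ℤ.+ y) ℤ.+ y) ℤ.+ ((s ℤ.+ y) ℤ.+ ((s ℤ.+ y) ℤ.+ + 0)) ≡ s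
    simplify = solve-∀

m≤2n⇒⌈m/2⌉≤n : ∀ {m n} → m ℕ.≤ 2 * n → ⌈ m /2⌉ ℕ.≤ n
m≤2n⇒⌈m/2⌉≤n {m} {n} m≤2n = subst (⌈ m /2⌉ ℕ.≤_) (sym (ℕₚ.n≡⌈n+n/2⌉ n))
  (ℕₚ.⌈n/2⌉-mono (subst (m ℕ.≤_) (cong (_+_ n) (ℕₚ.+-identityʳ n)) m≤2n))

n≤2*⌈n/2⌉ : ∀ n → n ℕ.≤ 2 * ⌈ n /2⌉
n≤2*⌈n/2⌉ n = begin
  n                          ≡⟨ sym (ℕₚ.⌊n/2⌋+⌈n/2⌉≡n n) ⟩
  ⌊ n /2⌋ + ⌈ n /2⌉          ≤⟨ ℕₚ.+-monoˡ-≤ ⌈ n /2⌉ (ℕₚ.⌊n/2⌋≤⌈n/2⌉ n) ⟩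
  ⌈ n /2⌉ + ⌈ n /2⌉          ≡⟨ cong (_+_ ⌈ n /2⌉) (sym (ℕₚ.+-identityʳ ⌈ n /2⌉)) ⟩
  2 * ⌈ n /2⌉                ∎
  where open ℕₚ.≤-Reasoning

⌈m+2/2⌉≤1+m : ∀ m → ⌈ m + 2 /2⌉ ℕ.≤ suc m
⌈m+2/2⌉≤1+m m = subst (ℕ._≤ suc m) (cong ⌈_/2⌉ (ℕₚ.+-comm 2 m)) (s≤s (ℕₚ.⌈n/2⌉≤n m))

1+m<2*⌈m+2/2⌉ : ∀ m → suc m < 2 * ⌈ m + 2 /2⌉
1+m<2*⌈m+2/2⌉ m = subst (ℕ._≤ 2 * ⌈ m + 2 /2⌉) (ℕₚ.+-comm m 2) (n≤2*⌈n/2⌉ (m + 2))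

m+2n≤2[⌈m/2⌉+o] : ∀ m {n o} → n ℕ.≤ o → m + 2 * n ℕ.≤ 2 * (⌈ m /2⌉ + o)
m+2n≤2[⌈m/2⌉+o] m {n} {o} n≤o = begin
  m + 2 * n                  ≤⟨ ℕₚ.+-mono-≤ (n≤2*⌈n/2⌉ m) (ℕₚ.*-monoʳ-≤ 2 n≤o) ⟩
  2 * ⌈ m /2⌉ + 2 * o        ≡⟨ sym (ℕₚ.*-distribˡ-+ 2 ⌈ m /2⌉ o) ⟩
  2 * (⌈ m /2⌉ + o)          ∎
  where open ℕₚ.≤-Reasoning

foldr-⊔-attained : {A : Set} (h : A → ℕ) (x : A) (xs : List A) →
  ∃[ y ] foldr (λ v acc → h v ⊔ acc) 0 (x ∷ xs) ≡ h y
foldr-⊔-attained h x []       = x , ℕₚ.⊔-identityʳ (h x)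
foldr-⊔-attained h x (y ∷ ys) with foldr-⊔-attained h y ys | ℕₚ.⊔-sel (h x) (foldr (λ v acc → h v ⊔ acc) 0 (y ∷ ys))
... | _ , _    | inj₁ ≡hx = x , ≡hx
... | z , ≡hz | inj₂ ≡rest = z , trans ≡rest ≡hz

foldr-⊓-≤ : {A : Set} (h : A → ℕ) (e : ℕ) {x : A} {xs : List A} → x ∈ˡ xs →
  foldr (λ v acc → h v ⊓ acc) e xs ℕ.≤ h x
foldr-⊓-≤ h e (here refl) = ℕₚ.m⊓n≤m _ _
foldr-⊓-≤ h e (there x∈)  = ℕₚ.≤-trans (ℕₚ.m⊓n≤n _ _) (foldr-⊓-≤ h e x∈)

maxDeg-attained : (G : Graph (suc m)) → ∃[ v ] maxDeg G ≡ deg G v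
maxDeg-attained {m} G = foldr-⊔-attained (deg G) zero (tabulate suc)

minDeg≤deg : (G : Graph (suc m)) (v : Fin (suc m)) → minDeg G ℕ.≤ deg G v
minDeg≤deg G v = foldr-⊓-≤ (deg G) (deg G zero) (∈-allFin v)

∣tabulate∣≡count : (d : Fin n → Bool) → ∣ Vec.tabulate d ∣ ≡ count d
∣tabulate∣≡count {zero}  d = refl
∣tabulate∣≡count {suc n} d with d zero
... | true  = cong suc (∣tabulate∣≡count (d ∘ suc))
... | false = ∣tabulate∣≡count (d ∘ suc)

∈-tabulate : (d : Fin n → Bool) {v : Fin n} → d v ≡ true → v ∈ Vec.tabulate d
∈-tabulate d {v} dv≡true = Vecₚ.lookup⇒[]= v (Vec.tabulate d) (trans (Vecₚ.lookup∘tabulate d v) dv≡true)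

closedNbhd : Graph n → Fin n → Fin n → Bool
closedNbhd G v u = ⌊ u ≟ v ⌋ ∨ adj G v u

count-closedNbhd : (G : Graph n) (v : Fin n) → count (closedNbhd G v) ≡ suc (deg G v)
count-closedNbhd G v = trans (count-insert (adj G v) v (adj-irrefl G v)) (cong suc (sym (deg≡count G v)))

meetsClosedNbhds⇒dominating : (G : Graph n) (d : Fin n → Bool) →
  (∀ v → ∃[ u ] closedNbhd G v u ∧ d u ≡ true) → IsDominating G (Vec.tabulate d)
meetsClosedNbhds⇒dominating G d meets v v∉D with meets v
... | u , u∈N[v]∩D with u ≟ v
... | yes refl = ⊥-elim (v∉D (∈-tabulate d u∈N[v]∩D))
... | no  _    with ∧≡true u∈N[v]∩D
...   | v~u , du = u , ∈-tabulate d du , v~u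

≡sign⌊≟1⌋ : ∀ {z} → z ≡ + 1 ⊎ z ≡ -[1+ 0 ] → z ≡ sign ⌊ z ℤ.≟ + 1 ⌋
≡sign⌊≟1⌋ (inj₁ refl) = refl
≡sign⌊≟1⌋ (inj₂ refl) = refl

m+n≡o⇒m<o⇒0<n : ∀ {m n o} → m + n ≡ o → m < o → 0 < n
m+n≡o⇒m<o⇒0<n {m} {zero}  m+0≡o m<o = ⊥-elim (ℕₚ.<-irrefl (trans (sym (ℕₚ.+-identityʳ m)) m+0≡o) m<o)
m+n≡o⇒m<o⇒0<n {n = suc n} _     _   = s≤s ℕ.z≤n

majority⇒2+d≤2a : ∀ {a b d} → a + b ≡ suc d → b < a → 2 + d ℕ.≤ 2 * a
majority⇒2+d≤2a {a} {b} {d} a+b≡1+d b<a = begin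
  2 + d        ≡⟨ cong suc (sym a+b≡1+d) ⟩
  suc (a + b)  ≡⟨ sym (ℕₚ.+-suc a b) ⟩
  a + suc b    ≤⟨ ℕₚ.+-monoʳ-≤ a b<a ⟩
  a + a        ≡⟨ cong (_+_ a) (sym (ℕₚ.+-identityʳ a)) ⟩
  2 * a        ∎
  where open ℕₚ.≤-Reasoning

module SignedDominatingFunction (G : Graph n) {f : Fin n → ℤ} (sdf : IsSDF G f) where

  positive : Fin n → Bool
  positive u = ⌊ f u ℤ.≟ + 1 ⌋

  p : ℕ
  p = count positive

  f≡sign : ∀ u → f u ≡ sign (positive u)
  f≡sign u = ≡sign⌊≟1⌋ (proj₁ sdf u)

  q : ℕ
  q = count (not ∘ positive)

  weight+q≡p : sumℤ f ℤ.+ + q ≡ + p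
  weight+q≡p = sumℤ-signed (λ _ → true) positive f f≡sign

  p+q≡n : p + q ≡ n
  p+q≡n = trans (count-∧-split (λ _ → true) positive) count-true

  positiveIn : Fin n → Fin n → Bool
  positiveIn v u = closedNbhd G v u ∧ positive u

  positiveIn≤p : ∀ v → count (positiveIn v) ℕ.≤ p
  positiveIn≤p v = count-mono (∧-⊆ʳ (closedNbhd G v) positive)

  2+deg≤2*positiveIn : ∀ v → 2 + deg G v ℕ.≤ 2 * count (positiveIn v)
  2+deg≤2*positiveIn v = majority⇒2+d≤2a
    (trans (count-∧-split (closedNbhd G v) positive) (count-closedNbhd G v))
    (1≤S⇒b<a (sumℤ-signed (closedNbhd G v) positive f f≡sign) (proj₂ sdf v))

  2+deg≤2p : ∀ v → 2 + deg G v ℕ.≤ 2 * p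
  2+deg≤2p v = ℕₚ.≤-trans (2+deg≤2*positiveIn v) (ℕₚ.*-monoʳ-≤ 2 (positiveIn≤p v))

  module _ (δ : ℕ) (δ≤deg : ∀ v → δ ℕ.≤ deg G v) where

    ⌈δ/2⌉<positiveIn : ∀ v → ⌈ δ /2⌉ < count (positiveIn v)
    ⌈δ/2⌉<positiveIn v = m≤2n⇒⌈m/2⌉≤n (ℕₚ.≤-trans (ℕₚ.+-monoʳ-≤ 2 (δ≤deg v)) (2+deg≤2*positiveIn v))

    positive∖r-dominating : (r : Fin n → Bool) → count r ≡ ⌈ δ /2⌉ →
      IsDominating G (Vec.tabulate (λ u → positive u ∧ not (r u)))
    positive∖r-dominating r |r|≡ = meetsClosedNbhds⇒dominating G _ meets
      where
      meets : ∀ v → ∃[ u ] closedNbhd G v u ∧ (positive u ∧ not (r u)) ≡ true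
      meets v with count>0⇒∃ (λ u → positiveIn v u ∧ not (r u))
                     (m+n≡o⇒m<o⇒0<n (count-∧-split (positiveIn v) r) in-r<positiveIn)
        where
        in-r<positiveIn : count (λ u → positiveIn v u ∧ r u) < count (positiveIn v)
        in-r<positiveIn = ℕₚ.≤-<-trans (count-mono (∧-⊆ʳ (positiveIn v) r))
                            (subst (_< count (positiveIn v)) (sym |r|≡) (⌈δ/2⌉<positiveIn v))
      ... | u , e = u , trans (sym (∧-assoc (closedNbhd G v u) (positive u) (not (r u)))) e

    ⌈δ/2⌉≤p : Fin n → ⌈ δ /2⌉ ℕ.≤ p
    ⌈δ/2⌉≤p v₀ = ℕₚ.<⇒≤ (ℕₚ.<-≤-trans (⌈δ/2⌉<positiveIn v₀) (positiveIn≤p v₀))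

    ⌈δ+2γ/2⌉≤p : ∀ {γ} → (∀ D → IsDominating G D → γ ℕ.≤ ∣ D ∣) → Fin n → ⌈ δ + 2 * γ /2⌉ ℕ.≤ p
    ⌈δ+2γ/2⌉≤p {γ} γ-minimal v₀ with ∃⊆-count≡ positive (⌈δ/2⌉≤p v₀)
    ... | r , r⊆positive , |r|≡ = m≤2n⇒⌈m/2⌉≤n (subst (λ x → δ + 2 * γ ℕ.≤ 2 * x) ⌈δ/2⌉+|D|≡p
          (m+2n≤2[⌈m/2⌉+o] δ (subst (γ ℕ.≤_) (∣tabulate∣≡count D) (γ-minimal _ (positive∖r-dominating r |r|≡)))))
      where
      D : Fin n → Bool
      D u = positive u ∧ not (r u)
      ⌈δ/2⌉+|D|≡p : ⌈ δ /2⌉ + count D ≡ p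
      ⌈δ/2⌉+|D|≡p = trans (cong (_+ count D) (sym |r|≡)) (count+count∖≡count r⊆positive)

bound≤weight : (G : Graph (suc m)) {γ : ℕ} {f : Fin (suc m) → ℤ} →
  IsDominationNumber G γ → IsSDF G f → bound (suc m) (maxDeg G) (minDeg G) γ ≤ sumℤ f
bound≤weight {m} G {γ} {f} (_ , γ-minimal) sdf = begin
  ℤ.- + suc m ℤ.+ + (2 * M)            ≡⟨ cong (λ t → ℤ.- + t ℤ.+ + (2 * M)) (sym p+q≡n) ⟩
  ℤ.- + (p + q) ℤ.+ + (2 * M)          ≤⟨ ℤₚ.+-monoʳ-≤ (ℤ.- + (p + q)) (ℤ.+≤+ (ℕₚ.*-monoʳ-≤ 2 M≤p)) ⟩
  ℤ.- + (p + q) ℤ.+ + (2 * p)          ≡⟨ -[a+b]+2a≡S weight+q≡p ⟩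
  sumℤ f                               ∎
  where
  open SignedDominatingFunction G sdf
  open ℤₚ.≤-Reasoning
  M : ℕ
  M = ⌈ maxDeg G + 2 /2⌉ ⊔ ⌈ minDeg G + 2 * γ /2⌉

  Δ-bound : ⌈ maxDeg G + 2 /2⌉ ℕ.≤ p
  Δ-bound with maxDeg-attained G
  ... | v , Δ≡deg rewrite Δ≡deg = m≤2n⇒⌈m/2⌉≤n (subst (ℕ._≤ 2 * p) (ℕₚ.+-comm 2 (deg G v)) (2+deg≤2p v))

  γ-bound : ⌈ minDeg G + 2 * γ /2⌉ ℕ.≤ p
  γ-bound = ⌈δ+2γ/2⌉≤p (minDeg G) (minDeg≤deg G) γ-minimal zero

  M≤p : M ℕ.≤ p
  M≤p = ℕₚ.⊔-lub Δ-bound γ-bound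

bound≤γs : (G : Graph (suc m)) {γ : ℕ} {γs : ℤ} →
  IsDominationNumber G γ → IsSignedDominationNumber G γs → bound (suc m) (maxDeg G) (minDeg G) γ ≤ γs
bound≤γs G γ-number ((f , f-sdf , weight≡γs) , _) = subst (_ ≤_) weight≡γs (bound≤weight G γ-number f-sdf)

adj-complete : {u v : Fin n} → ¬ u ≡ v → Adj (complete n) u v
adj-complete {u = u} {v} u≢v with u ≟ v
... | yes u≡v = ⊥-elim (u≢v u≡v)
... | no  _   = refl

closedNbhd-complete : (v u : Fin n) → closedNbhd (complete n) v u ≡ true
closedNbhd-complete v u with u ≟ v
... | yes _   = refl
... | no  u≢v = adj-complete (u≢v ∘ sym)

deg-complete : (v : Fin (suc m)) → deg (complete (suc m)) v ≡ m
deg-complete {m} v = ℕₚ.suc-injective (begin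
  suc (deg (complete (suc m)) v)           ≡⟨ sym (count-closedNbhd (complete (suc m)) v) ⟩
  count (closedNbhd (complete (suc m)) v)  ≡⟨ count-cong (closedNbhd-complete v) ⟩
  count {suc m} (λ _ → true)               ≡⟨ count-true ⟩
  suc m                                    ∎)
  where open ≡-Reasoning

maxDeg-complete : maxDeg (complete (suc m)) ≡ m
maxDeg-complete {m} with maxDeg-attained (complete (suc m))
... | v , Δ≡deg = trans Δ≡deg (deg-complete v)

minDeg-complete≤ : minDeg (complete (suc m)) ℕ.≤ m
minDeg-complete≤ {m} = subst (minDeg (complete (suc m)) ℕ.≤_) (deg-complete zero) (minDeg≤deg (complete (suc m)) zero)

γ-complete≤1 : {γ : ℕ} → IsDominationNumber (complete (suc m)) γ → γ ℕ.≤ 1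
γ-complete≤1 {m} {γ} (_ , γ-minimal) = subst (γ ℕ.≤_) (∣⁅x⁆∣≡1 {suc m} zero) (γ-minimal ⁅ zero ⁆ ⁅zero⁆-dominating)
  where
  ⁅zero⁆-dominating : IsDominating (complete (suc m)) ⁅ zero ⁆
  ⁅zero⁆-dominating v v∉ = zero , x∈⁅x⁆ zero , adj-complete (λ { refl → v∉ (x∈⁅x⁆ zero) })

sign-±1 : ∀ b → sign b ≡ + 1 ⊎ sign b ≡ -[1+ 0 ]
sign-±1 true  = inj₁ refl
sign-±1 false = inj₂ refl

complete-SDF : ∀ {P} → P ℕ.≤ n → n < 2 * P →
  ∃[ f ] IsSDF (complete n) f × sumℤ f ≡ ℤ.- + n ℤ.+ + (2 * P)
complete-SDF {n} {P} P≤n n<2P with ∃⊆-count≡ (λ _ → true) (subst (P ℕ.≤_) (sym count-true) P≤n)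
... | r , _ , |r|≡P = sign ∘ r , ((sign-±1 ∘ r) , 1≤f[N[v]]) , sym weight≡
  where
  Q : ℕ
  Q = count (not ∘ r)
  P+Q≡n : P + Q ≡ n
  P+Q≡n = trans (cong (_+ Q) (sym |r|≡P)) (trans (count-∧-split (λ _ → true) r) count-true)
  Q<P : Q < P
  Q<P = ℕₚ.+-cancelˡ-< P Q P (subst₂ _<_ (sym P+Q≡n) (cong (_+_ P) (ℕₚ.+-identityʳ P)) n<2P)
  1≤f[N[v]] : ∀ v → + 1 ≤ closedNbhdSum (complete n) (sign ∘ r) v
  1≤f[N[v]] v = b<a⇒1≤S
    (subst₂ (λ b a → closedNbhdSum (complete n) (sign ∘ r) v ℤ.+ + b ≡ + a)
      (count-cong (λ u → cong (_∧ not (r u)) (closedNbhd-complete v u)))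
      (trans (count-cong (λ u → cong (_∧ r u) (closedNbhd-complete v u))) |r|≡P)
      (sumℤ-signed (closedNbhd (complete n) v) r (sign ∘ r) (λ _ → refl)))
    Q<P
  weight≡ : ℤ.- + n ℤ.+ + (2 * P) ≡ sumℤ (sign ∘ r)
  weight≡ = trans (cong (λ t → ℤ.- + t ℤ.+ + (2 * P)) (sym P+Q≡n))
    (-[a+b]+2a≡S (trans (sumℤ-signed (λ _ → true) r (sign ∘ r) (λ _ → refl)) (cong +_ |r|≡P)))

bound-complete : {γ : ℕ} → IsDominationNumber (complete (suc m)) γ →
  bound (suc m) (maxDeg (complete (suc m))) (minDeg (complete (suc m))) γ ≡ ℤ.- + suc m ℤ.+ + (2 * ⌈ m + 2 /2⌉)
bound-complete {m} {γ} γ-number = cong (λ t → ℤ.- + suc m ℤ.+ + (2 * t)) (begin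
  ⌈ maxDeg K + 2 /2⌉ ⊔ ⌈ minDeg K + 2 * γ /2⌉  ≡⟨ cong (λ Δ → ⌈ Δ + 2 /2⌉ ⊔ ⌈ minDeg K + 2 * γ /2⌉) maxDeg-complete ⟩
  ⌈ m + 2 /2⌉ ⊔ ⌈ minDeg K + 2 * γ /2⌉         ≡⟨ ℕₚ.m≥n⇒m⊔n≡m (ℕₚ.⌈n/2⌉-mono δ+2γ≤m+2) ⟩
  ⌈ m + 2 /2⌉                                  ∎)
  where
  open ≡-Reasoning
  K : Graph (suc m)
  K = complete (suc m)
  δ+2γ≤m+2 : minDeg K + 2 * γ ℕ.≤ m + 2
  δ+2γ≤m+2 = ℕₚ.+-mono-≤ minDeg-complete≤ (ℕₚ.*-monoʳ-≤ 2 (γ-complete≤1 γ-number))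

γs≤bound-complete : {γ : ℕ} {γs : ℤ} → IsDominationNumber (complete (suc m)) γ →
  IsSignedDominationNumber (complete (suc m)) γs →
  γs ≤ bound (suc m) (maxDeg (complete (suc m))) (minDeg (complete (suc m))) γ
γs≤bound-complete {m} {γ} {γs} γ-number (_ , γs-minimal) =
  weight-bound (complete-SDF (⌈m+2/2⌉≤1+m m) (1+m<2*⌈m+2/2⌉ m))
  where
  weight-bound : ∃[ f ] IsSDF (complete (suc m)) f × sumℤ f ≡ ℤ.- + suc m ℤ.+ + (2 * ⌈ m + 2 /2⌉) →
    γs ≤ bound (suc m) (maxDeg (complete (suc m))) (minDeg (complete (suc m))) γ
  weight-bound (f , f-sdf , weight≡) = subst (γs ≤_) (trans weight≡ (sym (bound-complete γ-number))) (γs-minimal f f-sdf)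

theorem3p3 :
    ((m : ℕ) (G : Graph (suc m)) → Connected G → (γ : ℕ) (γs : ℤ) →
      IsDominationNumber G γ → IsSignedDominationNumber G γs →
      bound (suc m) (maxDeg G) (minDeg G) γ ≤ γs)
    × ((m : ℕ) → (γ : ℕ) (γs : ℤ) →
      IsDominationNumber (complete (suc m)) γ →
      IsSignedDominationNumber (complete (suc m)) γs →
      γs ≡ bound (suc m) (maxDeg (complete (suc m))) (minDeg (complete (suc m))) γ)
theorem3p3 =
  (λ m G _ γ γs → bound≤γs G) ,
  (λ m γ γs γ-number γs-number →
     ℤₚ.≤-antisym (γs≤bound-complete γ-number γs-number) (bound≤γs (complete (suc m)) γ-number γs-number))
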